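{- Consider the Game of Cards with $p$ players and $n$ cards. Let $a$ and $b$ be two non-dual configurations such that $b$ is reachable from $a$ by a (finite) sequence of moves. Then all sequences of moves from $a$ to $b$ have the same shot vector, and hence the same length.
   Context: Game of Cards: $p$ players sit in a cycle; indices are taken modulo $p$ (player $p$'s right neighbor is player $1$). A configuration is a vector $a=(a_1,\dots,a_p)$ of nonnegative integers with $\sum_i a_i=n$. A move at position $i$ is allowed in $a$ iff $a_i>a_{i+1}$ (with $a_{p+1}=a_1$); it replaces $a_i$ by $a_i-1$ and $a_{i+1}$ by $a_{i+1}+1$. Let $\mathcal G$ be the directed graph on configurations with an arc $a\to b$ whenever $b$ is obtained from $a$ by one move. A configuration is dual if it lies on a directed cycle of positive length in $\mathcal G$, and non-dual otherwise. The shot vector of a sequence of moves $\mathcal C$ is $(s_1(\mathcal C),\dots,s_p(\mathcal C))$, where $s_i(\mathcal C)$ is the number of moves at position $i$; the length of $\mathcal C$ is $\sum_i s_i(\mathcal C)$. -}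

module Defs where

open import Data.Nat using (ℕ; zero; suc; _+_; _∸_; _<_)
open import Data.Fin using (Fin; zero; suc)
open import Data.Fin.Base using (fromℕ; inject₁)
open import Data.Product using (Σ; _×_; _,_)
open import Relation.Binary.PropositionalEquality using (_≡_; _≢_)
open import Relation.Nullary using (¬_)
open import Relation.Nullary.Decidable using (does)
open import Data.Fin.Properties using (_≟_)
open import Data.Bool using (if_then_else_)
open import Data.List using (List; []; _∷_; length)

total : {p : ℕ} → (Fin p → ℕ) → ℕ
total {zero}  a = 0
total {suc p} a = a zero + total (λ i → a (suc i))

Config : ℕ → ℕ → Set
Config p n = Σ (Fin p → ℕ) λ a → total a ≡ n

-- Right neighbour of player i, indices modulo p (last player → first player).
next : {p : ℕ} → Fin p → Fin p
next {suc zero}    zero    = zero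
next {suc (suc p)} zero    = suc zero
next {suc (suc p)} (suc i) with next {suc p} i
... | zero  = zero
... | suc j = suc (suc j)

applyMove : {p : ℕ} → Fin p → (Fin p → ℕ) → (Fin p → ℕ)
applyMove i a j =
  if does (j ≟ i) then a j ∸ 1
  else if does (j ≟ next i) then suc (a j)
  else a j

MoveStep : {p n : ℕ} → Config p n → Fin p → Config p n → Set
MoveStep {p} (a , _) i (b , _) = (a (next i) < a i) × (∀ j → b j ≡ applyMove i a j)

data Seq {p n : ℕ} : Config p n → Config p n → List (Fin p) → Set where
  done : ∀ {a} → Seq a a []
  step : ∀ {a b c i is} → MoveStep a i b → Seq b c is → Seq a c (i ∷ is)

count : {p : ℕ} → Fin p → List (Fin p) → ℕ
count i [] = 0
count i (j ∷ js) = if does (i ≟ j) then suc (count i js) else count i js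

shot : {p : ℕ} → List (Fin p) → Fin p → ℕ
shot is i = count i is

Reachable : {p n : ℕ} → Config p n → Config p n → Set
Reachable a b = Σ (List _) λ is → Seq a b is

Dual : {p n : ℕ} → Config p n → Set
Dual a = Σ (List _) λ is → Seq a a is × (0 < length is)

NonDual : {p n : ℕ} → Config p n → Set
NonDual a = ¬ Dual a

-- A move at i only lowers a_i and raises a_{i+1}, so a legal move stays legal
-- after a move at another position, and two distinct legal moves commute.
-- Hence, if the shot vector of a play from x to y is dominated by that of a
-- play from x to z, the latter can be reordered to pass through y, leaving a
-- play from y to z whose shot vector is the difference. Counting the cards of
-- each player shows that two plays from a to b have shot vectors differing by
-- a constant vector, so one dominates the other, and the leftover is a cycle
-- at b, which must be empty when b is non-dual.
module Submission where

open import Defs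
open import Data.Nat using (ℕ; zero; suc; _+_; _∸_; _≤_; _<_; z≤n; z<s)
open import Data.Nat.Properties
  using (+-comm; +-assoc; +-identityʳ; +-cancelˡ-≡; +-cancelʳ-≡; +-cancelˡ-≤; +-cancelʳ-≤;
         +-monoʳ-≤; ≤-refl; ≤-total; ≤-<-trans; <-≤-trans; <-irrefl; n≤1+n; m∸n≤m; m∸n+n≡m;
         +-commutativeSemigroup)
open import Algebra.Properties.CommutativeSemigroup +-commutativeSemigroup
  using (interchange; x∙yz≈y∙xz; xy∙z≈xz∙y; xy∙z≈y∙xz)
open import Data.Fin using (Fin; zero; suc; inject₁)
open import Data.Fin.Properties using (_≟_; suc-injective)
open import Data.Fin.Induction using (<-weakInduction)
open import Data.List using (List; []; _∷_; length)
open import Data.Product using (Σ; _×_; _,_; proj₁)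
open import Data.Sum using (inj₁; inj₂)
open import Data.Bool using (if_then_else_)
open import Data.Empty using (⊥-elim)
open import Function using (_∘_)
open import Relation.Nullary using (yes; no; does)
open import Relation.Binary.PropositionalEquality
  using (_≡_; _≢_; _≗_; refl; sym; trans; cong; cong₂; subst; subst₂; ≢-sym; module ≡-Reasoning)
open ≡-Reasoning

private variable
  p n : ℕ
  i j k : Fin p
  x x′ y z : Fin p → ℕ
  S T : List (Fin p)

balance-trans : (u v w : ℕ) {a b c d : ℕ} →
                u + a ≡ v + b → v + c ≡ w + d → u + (a + c) ≡ w + (d + b)
balance-trans u v w {a} {b} {c} {d} u+a≡v+b v+c≡w+d = begin
  u + (a + c)  ≡⟨ +-assoc u a c ⟨
  u + a + c    ≡⟨ cong (_+ c) u+a≡v+b ⟩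
  v + b + c    ≡⟨ xy∙z≈xz∙y v b c ⟩
  v + c + b    ≡⟨ cong (_+ b) v+c≡w+d ⟩
  w + d + b    ≡⟨ +-assoc w d b ⟩
  w + (d + b)  ∎

balance-difference : (u v : ℕ) {a b c d : ℕ} → u + a ≡ v + b → u + c ≡ v + d → a + d ≡ b + c
balance-difference u v {a} {b} {c} {d} u+a≡v+b u+c≡v+d = +-cancelˡ-≡ u _ _ (begin
  u + (a + d)  ≡⟨ +-assoc u a d ⟨
  u + a + d    ≡⟨ cong (_+ d) u+a≡v+b ⟩
  v + b + d    ≡⟨ xy∙z≈y∙xz v b d ⟩
  b + (v + d)  ≡⟨ cong (b +_) u+c≡v+d ⟨
  b + (u + c)  ≡⟨ x∙yz≈y∙xz b u c ⟩
  u + (b + c)  ∎)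

-- a + d ≡ c + b encodes a − b = c − d, so this is transitivity of differences.
difference-trans : (a c e : ℕ) {b d f : ℕ} → a + d ≡ c + b → c + f ≡ e + d → a + f ≡ e + b
difference-trans a c e {b} {d} {f} a+d≡c+b c+f≡e+d = +-cancelʳ-≡ d _ _ (begin
  a + f + d  ≡⟨ xy∙z≈xz∙y a f d ⟩
  a + d + f  ≡⟨ cong (_+ f) a+d≡c+b ⟩
  c + b + f  ≡⟨ xy∙z≈xz∙y c b f ⟩
  c + f + b  ≡⟨ cong (_+ b) c+f≡e+d ⟩
  e + d + b  ≡⟨ xy∙z≈xz∙y e d b ⟩
  e + b + d  ∎)

δ : Fin p → Fin p → ℕ
δ j k = if does (j ≟ k) then 1 else 0

δ-refl : (j : Fin p) → δ j j ≡ 1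
δ-refl j with j ≟ j
... | yes _  = refl
... | no j≢j = ⊥-elim (j≢j refl)

δ-≢ : j ≢ k → δ j k ≡ 0
δ-≢ {j = j} {k = k} j≢k with j ≟ k
... | yes j≡k = ⊥-elim (j≢k j≡k)
... | no _    = refl

count-∷ : (j k : Fin p) (T : List (Fin p)) → count j (k ∷ T) ≡ δ j k + count j T
count-∷ j k T with j ≟ k
... | yes _ = refl
... | no _  = refl

count-∷-self : (i : Fin p) (T : List (Fin p)) → count i (i ∷ T) ≡ suc (count i T)
count-∷-self i T = trans (count-∷ i i T) (cong (_+ count i T) (δ-refl i))

total-cong : {f g : Fin p → ℕ} → f ≗ g → total f ≡ total g
total-cong {zero}  f≗g = refl
total-cong {suc p} f≗g = cong₂ _+_ (f≗g zero) (total-cong (f≗g ∘ suc))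

total-+ : (f g : Fin p → ℕ) → total (λ j → f j + g j) ≡ total f + total g
total-+ {zero}  f g = refl
total-+ {suc p} f g = trans (cong (f zero + g zero +_) (total-+ (f ∘ suc) (g ∘ suc)))
                            (interchange (f zero) (g zero) (total (f ∘ suc)) (total (g ∘ suc)))

total-zero : total {p} (λ _ → 0) ≡ 0
total-zero {zero}  = refl
total-zero {suc p} = total-zero {p}

total-δ : (k : Fin p) → total (λ j → δ j k) ≡ 1
total-δ {suc p} zero    = cong suc (total-zero {p})
total-δ {suc p} (suc k) = total-δ k

length≡total-count : (T : List (Fin p)) → length T ≡ total (λ j → count j T)
length≡total-count {p} []  = sym (total-zero {p})
length≡total-count (k ∷ T) = begin
  suc (length T)                          ≡⟨ cong suc (length≡total-count T) ⟩
  1 + total (λ j → count j T)             ≡⟨ cong (_+ total (λ j → count j T)) (total-δ k) ⟨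
  total (λ j → δ j k) + total (λ j → count j T)
                                          ≡⟨ total-+ (λ j → δ j k) (λ j → count j T) ⟨
  total (λ j → δ j k + count j T)         ≡⟨ total-cong (λ j → count-∷ j k T) ⟨
  total (λ j → count j (k ∷ T))           ∎

next-injective : next i ≡ next j → i ≡ j
next-injective {suc zero}    {i = zero}  {zero}  _ = refl
next-injective {suc (suc p)} {i = zero}  {zero}  _ = refl
next-injective {suc (suc p)} {i = zero}  {suc j} e with next {suc p} j
next-injective {suc (suc p)} {i = zero}  {suc j} () | zero
next-injective {suc (suc p)} {i = zero}  {suc j} () | suc _
next-injective {suc (suc p)} {i = suc i} {zero}  e with next {suc p} i
next-injective {suc (suc p)} {i = suc i} {zero}  () | zero
next-injective {suc (suc p)} {i = suc i} {zero}  () | suc _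
next-injective {suc (suc p)} {i = suc i} {suc j} e with next {suc p} i in eqᵢ | next {suc p} j in eqⱼ
... | zero  | zero  = cong suc (next-injective (trans eqᵢ (sym eqⱼ)))
... | suc _ | suc _ =
  cong suc (next-injective (trans eqᵢ (trans (cong suc (suc-injective (suc-injective e))) (sym eqⱼ))))
next-injective {suc (suc p)} {i = suc i} {suc j} () | zero  | suc _
next-injective {suc (suc p)} {i = suc i} {suc j} () | suc _ | zero

next-inject₁ : (i : Fin p) → next (inject₁ i) ≡ suc i
next-inject₁ {suc p} zero    = refl
next-inject₁ {suc p} (suc i) rewrite next-inject₁ i = refl

next-induction : (P : Fin (suc p) → Set) → P zero → (∀ i → P i → P (next i)) → ∀ i → P i
next-induction P P₀ P⇒P∘next =
  <-weakInduction P P₀ (λ i P[i] → subst P (next-inject₁ i) (P⇒P∘next (inject₁ i) P[i]))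

δ-next : (i k : Fin p) → δ (next i) (next k) ≡ δ i k
δ-next i k with i ≟ k
... | yes refl = δ-refl (next i)
... | no i≢k   = δ-≢ (i≢k ∘ next-injective)

record Legal (i : Fin p) (x : Fin p → ℕ) : Set where
  constructor legal
  field descent : x (next i) < x i

applyMove-balance : Legal i x → ∀ j → applyMove i x j + δ j i ≡ x j + δ j (next i)
applyMove-balance {i = i} {x = x} (legal descent) j with j ≟ i | j ≟ next i
... | yes refl | yes j≡next-j = ⊥-elim (<-irrefl (cong x (sym j≡next-j)) descent)
... | yes refl | no _         = trans (m∸n+n≡m (≤-<-trans z≤n descent)) (sym (+-identityʳ (x i)))
... | no _     | yes _        = trans (+-identityʳ (suc (x j))) (+-comm 1 (x j))
... | no _     | no _         = refl

applyMove-cong : x ≗ x′ → applyMove i x ≗ applyMove i x′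
applyMove-cong {i = i} x≗x′ j with j ≟ i | j ≟ next i
... | yes _ | _     = cong (_∸ 1) (x≗x′ j)
... | no _  | yes _ = cong suc (x≗x′ j)
... | no _  | no _  = x≗x′ j

≤-applyMove : (i : Fin p) (x : Fin p → ℕ) → j ≢ i → x j ≤ applyMove i x j
≤-applyMove {j = j} i x j≢i with j ≟ i | j ≟ next i
... | yes j≡i | _     = ⊥-elim (j≢i j≡i)
... | no _    | yes _ = n≤1+n (x j)
... | no _    | no _  = ≤-refl

applyMove-≤ : (i : Fin p) (x : Fin p → ℕ) → j ≢ next i → applyMove i x j ≤ x j
applyMove-≤ {j = j} i x j≢next-i with j ≟ i | j ≟ next i
... | yes _ | _          = m∸n≤m (x j) 1
... | no _  | yes j≡next = ⊥-elim (j≢next-i j≡next)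
... | no _  | no _       = ≤-refl

Legal-applyMove : Legal k x → k ≢ i → Legal k (applyMove i x)
Legal-applyMove {k = k} {x = x} {i = i} (legal descent) k≢i = legal (
  ≤-<-trans (applyMove-≤ i x (k≢i ∘ next-injective)) (<-≤-trans descent (≤-applyMove i x k≢i)))

applyMove-total : Legal i x → total (applyMove i x) ≡ total x
applyMove-total {i = i} {x = x} legalᵢ = +-cancelʳ-≡ 1 _ _ (begin
  total (applyMove i x) + 1                      ≡⟨ cong (total (applyMove i x) +_) (total-δ i) ⟨
  total (applyMove i x) + total (λ j → δ j i)    ≡⟨ total-+ (applyMove i x) (λ j → δ j i) ⟨
  total (λ j → applyMove i x j + δ j i)          ≡⟨ total-cong (applyMove-balance legalᵢ) ⟩
  total (λ j → x j + δ j (next i))               ≡⟨ total-+ x (λ j → δ j (next i)) ⟩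
  total x + total (λ j → δ j (next i))           ≡⟨ cong (total x +_) (total-δ (next i)) ⟩
  total x + 1                                    ∎)

applyMove²-balance : Legal i x → Legal k (applyMove i x) →
  ∀ j → applyMove k (applyMove i x) j + (δ j k + δ j i) ≡ x j + (δ j (next i) + δ j (next k))
applyMove²-balance {i = i} {x = x} {k = k} legalᵢ legalₖ j =
  balance-trans (applyMove k (applyMove i x) j) (applyMove i x j) (x j)
                (applyMove-balance legalₖ j) (applyMove-balance legalᵢ j)

applyMove-comm : Legal i x → Legal k x → i ≢ k →
                 applyMove k (applyMove i x) ≗ applyMove i (applyMove k x)
applyMove-comm {i = i} {x = x} {k = k} legalᵢ legalₖ i≢k j = +-cancelʳ-≡ (δ j k + δ j i) _ _ (begin
  applyMove k (applyMove i x) j + (δ j k + δ j i)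
    ≡⟨ applyMove²-balance legalᵢ (Legal-applyMove legalₖ (≢-sym i≢k)) j ⟩
  x j + (δ j (next i) + δ j (next k))
    ≡⟨ cong (x j +_) (+-comm (δ j (next i)) (δ j (next k))) ⟩
  x j + (δ j (next k) + δ j (next i))
    ≡⟨ applyMove²-balance legalₖ (Legal-applyMove legalᵢ i≢k) j ⟨
  applyMove i (applyMove k x) j + (δ j i + δ j k)
    ≡⟨ cong (applyMove i (applyMove k x) j +_) (+-comm (δ j i) (δ j k)) ⟩
  applyMove i (applyMove k x) j + (δ j k + δ j i) ∎)

-- Plays on bare card vectors, with the endpoint only pointwise equal to y: reordering
-- moves yields pointwise-equal, not definitionally equal, configurations.
data Run {p : ℕ} : (Fin p → ℕ) → (Fin p → ℕ) → List (Fin p) → Set where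
  halt : x ≗ y → Run x y []
  move : Legal i x → Run (applyMove i x) y T → Run x y (i ∷ T)

Run-respˡ : x ≗ x′ → Run x y T → Run x′ y T
Run-respˡ x≗x′ (halt x≗y)                 = halt (λ j → trans (sym (x≗x′ j)) (x≗y j))
Run-respˡ x≗x′ (move (legal descent) run) =
  move (legal (subst₂ _<_ (x≗x′ _) (x≗x′ _) descent)) (Run-respˡ (applyMove-cong x≗x′) run)

Seq⇒Run : {a b : Config p n} → Seq a b T → Run (proj₁ a) (proj₁ b) T
Seq⇒Run done                           = halt (λ _ → refl)
Seq⇒Run (step (descent , b≗moved) seq) = move (legal descent) (Run-respˡ b≗moved (Seq⇒Run seq))

-- Nonempty, since done needs a and b to be definitionally equal.
Run⇒Seq : (a b : Config p n) → Run (proj₁ a) (proj₁ b) (i ∷ T) → Seq a b (i ∷ T)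
Run⇒Seq a b (move (legal descent) (halt a′≗b)) = step (descent , sym ∘ a′≗b) done
Run⇒Seq (x , Σx≡n) b (move {i = i} legalᵢ@(legal descent) run@(move _ _)) =
  step {b = applyMove i x , trans (applyMove-total legalᵢ) Σx≡n}
       (descent , λ _ → refl) (Run⇒Seq _ b run)

remove : Fin p → List (Fin p) → List (Fin p)
remove i []      = []
remove i (k ∷ T) = if does (i ≟ k) then T else k ∷ remove i T

count-∷-remove : (T : List (Fin p)) → 0 < count i T → ∀ j → count j (i ∷ remove i T) ≡ count j T
count-∷-remove [] ()
count-∷-remove {i = i} (k ∷ T) i∈T j with i ≟ k
... | yes refl = refl
... | no _     = begin
  count j (i ∷ k ∷ remove i T)        ≡⟨ count-∷ j i (k ∷ remove i T) ⟩
  δ j i + count j (k ∷ remove i T)    ≡⟨ cong (δ j i +_) (count-∷ j k (remove i T)) ⟩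
  δ j i + (δ j k + count j (remove i T))
                                      ≡⟨ x∙yz≈y∙xz (δ j i) (δ j k) (count j (remove i T)) ⟩
  δ j k + (δ j i + count j (remove i T))
                                      ≡⟨ cong (δ j k +_) (count-∷ j i (remove i T)) ⟨
  δ j k + count j (i ∷ remove i T)    ≡⟨ cong (δ j k +_) (count-∷-remove T i∈T j) ⟩
  δ j k + count j T                   ≡⟨ count-∷ j k T ⟨
  count j (k ∷ T)                     ∎

Run-remove : Run x y T → Legal i x → 0 < count i T → Run (applyMove i x) y (remove i T)
Run-remove (halt _) _ ()
Run-remove {i = i} (move {i = k} legalₖ run) legalᵢ i∈T with i ≟ k
... | yes refl = run
... | no i≢k   =
  move (Legal-applyMove legalₖ (≢-sym i≢k))
       (Run-respˡ (applyMove-comm legalₖ legalᵢ (≢-sym i≢k))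
                  (Run-remove run (Legal-applyMove legalᵢ i≢k) i∈T))

Run-residual : Run x y S → Run x z T → (∀ j → shot S j ≤ shot T j) →
               Σ (List (Fin p)) λ U → Run y z U × (∀ j → shot U j + shot S j ≡ shot T j)
Run-residual {T = T} (halt x≗y) runT _ = T , Run-respˡ x≗y runT , λ j → +-identityʳ (count j T)
Run-residual {S = i ∷ S} {T = T} (move legalᵢ runS) runT S≤T =
  let U , runU , U+S≡T∖i = Run-residual runS (Run-remove runT legalᵢ i∈T) S≤T∖i
  in U , runU , λ j → begin
    count j U + count j (i ∷ S)          ≡⟨ cong (count j U +_) (count-∷ j i S) ⟩
    count j U + (δ j i + count j S)      ≡⟨ x∙yz≈y∙xz (count j U) (δ j i) (count j S) ⟩
    δ j i + (count j U + count j S)      ≡⟨ cong (δ j i +_) (U+S≡T∖i j) ⟩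
    δ j i + count j (remove i T)         ≡⟨ count-∷ j i (remove i T) ⟨
    count j (i ∷ remove i T)             ≡⟨ count-∷-remove T i∈T j ⟩
    count j T                            ∎
  where
  i∈T : 0 < count i T
  i∈T = <-≤-trans (subst (0 <_) (sym (count-∷-self i S)) z<s) (S≤T i)

  S≤T∖i : ∀ j → count j S ≤ count j (remove i T)
  S≤T∖i j = +-cancelˡ-≤ (δ j i) _ _
    (subst₂ _≤_ (count-∷ j i S)
                (trans (sym (count-∷-remove T i∈T j)) (count-∷ j i (remove i T)))
                (S≤T j))

Run-balance : Run x y T → ∀ i → y (next i) + count (next i) T ≡ x (next i) + count i T
Run-balance (halt x≗y) i = cong (_+ 0) (sym (x≗y (next i)))
Run-balance {x = x} {y = y} (move {i = k} {T = T} legalₖ run) i = begin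
  y (next i) + count (next i) (k ∷ T)
    ≡⟨ cong (y (next i) +_) (count-∷ (next i) k T) ⟩
  y (next i) + (δ (next i) k + count (next i) T)
    ≡⟨ cong (y (next i) +_) (+-comm (δ (next i) k) (count (next i) T)) ⟩
  y (next i) + (count (next i) T + δ (next i) k)
    ≡⟨ balance-trans (y (next i)) (applyMove k x (next i)) (x (next i))
                     (Run-balance run i) (applyMove-balance legalₖ (next i)) ⟩
  x (next i) + (δ (next i) (next k) + count i T)
    ≡⟨ cong (λ d → x (next i) + (d + count i T)) (δ-next i k) ⟩
  x (next i) + (δ i k + count i T)
    ≡⟨ cong (x (next i) +_) (count-∷ i k T) ⟨
  x (next i) + count i (k ∷ T)                      ∎

Run-shot-difference-step : Run x y S → Run x y T →
  ∀ i → shot S (next i) + shot T i ≡ shot S i + shot T (next i)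
Run-shot-difference-step {x = x} {y = y} runS runT i =
  balance-difference (y (next i)) (x (next i)) (Run-balance runS i) (Run-balance runT i)

Run-shot-difference-constant : Run x y S → Run x y T →
  ∀ j → shot S j + shot T zero ≡ shot S zero + shot T j
Run-shot-difference-constant {S = S} {T = T} runS runT =
  next-induction (λ j → shot S j + shot T zero ≡ shot S zero + shot T j) refl
    (λ i → difference-trans (shot S (next i)) (shot S i) (shot S zero)
                            (Run-shot-difference-step runS runT i))

Run-shot-≤ : Run x y S → Run x y T → shot S zero ≤ shot T zero → ∀ j → shot S j ≤ shot T j
Run-shot-≤ {S = S} {T = T} runS runT S₀≤T₀ j = +-cancelʳ-≤ (shot S zero) _ _
  (subst₂ _≤_ refl
           (trans (Run-shot-difference-constant runS runT j) (+-comm (shot S zero) (shot T j)))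
           (+-monoʳ-≤ (shot S j) S₀≤T₀))

Acyclic : (Fin p → ℕ) → Set
Acyclic y = ∀ {U} → Run y y U → U ≡ []

NonDual⇒Acyclic : (b : Config p n) → NonDual b → Acyclic (proj₁ b)
NonDual⇒Acyclic b nonDual (halt _)       = refl
NonDual⇒Acyclic b nonDual run@(move _ _) = ⊥-elim (nonDual (_ , Run⇒Seq b b run , z<s))

Run-shot-≤⇒≡ : Acyclic y → Run x y S → Run x y T → (∀ j → shot S j ≤ shot T j) → shot S ≗ shot T
Run-shot-≤⇒≡ {S = S} {T = T} acyclic runS runT S≤T =
  let U , runU , U+S≡T = Run-residual runS runT S≤T
  in subst (λ U → ∀ j → shot U j + shot S j ≡ shot T j) (acyclic runU) U+S≡T

Run-shot-unique : Acyclic y → Run x y S → Run x y T → shot S ≗ shot T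
Run-shot-unique {zero} _ _ _ ()
Run-shot-unique {suc _} {S = S} {T = T} acyclic runS runT
  with ≤-total (shot S zero) (shot T zero)
... | inj₁ S₀≤T₀ = Run-shot-≤⇒≡ acyclic runS runT (Run-shot-≤ runS runT S₀≤T₀)
... | inj₂ T₀≤S₀ = sym ∘ Run-shot-≤⇒≡ acyclic runT runS (Run-shot-≤ runT runS T₀≤S₀)

proposition1 : (p n : ℕ) (a b : Config p n) → NonDual a → NonDual b → Reachable a b →
    ∀ (is js : List (Fin p)) → Seq a b is → Seq a b js →
    ((i : Fin p) → shot is i ≡ shot js i) × (length is ≡ length js)
proposition1 p n a b _ nonDualᵇ _ is js seqᵢₛ seqⱼₛ = shots-equal , lengths-equal
  where
  shots-equal : shot is ≗ shot js
  shots-equal = Run-shot-unique (NonDual⇒Acyclic b nonDualᵇ) (Seq⇒Run seqᵢₛ) (Seq⇒Run seqⱼₛ)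

  lengths-equal : length is ≡ length js
  lengths-equal = begin
    length is                    ≡⟨ length≡total-count is ⟩
    total (λ j → count j is)     ≡⟨ total-cong shots-equal ⟩
    total (λ j → count j js)     ≡⟨ length≡total-count js ⟨
    length js                    ∎
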